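{- Let $k\ge 2$ and $P=\{A^k+B^k\mid A,B\in M_2(\mathbb F_2)\}$. Then $P=M_2(\mathbb F_2)$ if $k\not\equiv 0 \pmod 6$, and $P=M_2(\mathbb F_2)\setminus\left\{\begin{pmatrix}1&1\\1&0\end{pmatrix},\begin{pmatrix}0&1\\1&1\end{pmatrix}\right\}$ (the two invertible matrices of order 3) if $k\equiv 0\pmod 6$. -}

module Defs where

open import Data.Bool using (Bool; true; false; _xor_; _∧_)
open import Data.Nat using (ℕ; zero; suc)
open import Data.Product using (∃-syntax; _,_)
open import Relation.Binary.PropositionalEquality using (_≡_)

-- The field F₂ = {0,1}: Bool with addition = xor and multiplication = ∧
-- (false = 0, true = 1).
F₂ : Set
F₂ = Bool

-- 2×2 matrices over F₂, ( a b ; c d ) written  mat a b c d .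
record M₂ : Set where
  constructor mat
  field
    a b c d : F₂

open M₂ public

infixl 6 _⊕_
infixl 7 _⊗_

_⊕_ : M₂ → M₂ → M₂
mat a₁ b₁ c₁ d₁ ⊕ mat a₂ b₂ c₂ d₂ = mat (a₁ xor a₂) (b₁ xor b₂) (c₁ xor c₂) (d₁ xor d₂)

_⊗_ : M₂ → M₂ → M₂
mat a₁ b₁ c₁ d₁ ⊗ mat a₂ b₂ c₂ d₂ =
  mat ((a₁ ∧ a₂) xor (b₁ ∧ c₂)) ((a₁ ∧ b₂) xor (b₁ ∧ d₂))
      ((c₁ ∧ a₂) xor (d₁ ∧ c₂)) ((c₁ ∧ b₂) xor (d₁ ∧ d₂))

I₂ : M₂
I₂ = mat true false false true

_^ᴹ_ : M₂ → ℕ → M₂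
A ^ᴹ zero = I₂
A ^ᴹ suc k = A ⊗ (A ^ᴹ k)

InP : ℕ → M₂ → Set
InP k C = ∃[ A ] ∃[ B ] (A ^ᴹ k ⊕ B ^ᴹ k ≡ C)

J₁ : M₂
J₁ = mat true true true false

J₂ : M₂
J₂ = mat false true true true

{-# OPTIONS --safe #-}
module Submission where

-- Every A ∈ M₂(F₂) is either nilpotent (A² = 0), singular with A² = (tr A)·A, or
-- invertible of order 1, 2 or 3; hence A⁸ = A², and the k-th powers, and with them
-- P, depend only on k mod 6 once k ≥ 2.  This reduces the theorem to k = 2, …, 7,
-- which are finitely many decidable statements about a 16-element set.  For k ≡ 0
-- the sixth powers are 0, I and the rank-1 idempotents (trace 1); a sum of two of
-- them is either again a sixth power or has trace 0, and J₁, J₂ are neither.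

open import Defs
open import Data.Bool using (Bool; true; false)
import Data.Bool.Properties as Bool
open import Data.Nat using (ℕ; suc; _≤_; _%_; _+_; s≤s; z≤n)
open import Data.Nat.DivMod using ([m+n]%n≡m%n)
open import Data.Nat.Properties using (+-comm; _≟_)
open import Data.Product using (∃; _×_; _,_)
open import Data.Sum using (inj₁; inj₂)
open import Function.Bundles using (_⇔_; mk⇔; Equivalence)
open import Relation.Binary.PropositionalEquality
  using (_≡_; _≢_; refl; sym; trans; cong; cong₂)
open import Relation.Nullary using (Dec)
open import Relation.Nullary.Decidable
  using (map′; from-yes; ¬?; _×-dec_; _⊎-dec_; _→-dec_)

_⇔-dec_ : {A B : Set} → Dec A → Dec B → Dec (A ⇔ B)
a? ⇔-dec b? =
  map′ (λ (f , g) → mk⇔ f g) (λ e → Equivalence.to e , Equivalence.from e)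
       ((a? →-dec b?) ×-dec (b? →-dec a?))

∀-Bool? : {P : Bool → Set} → ((b : Bool) → Dec (P b)) → Dec ((b : Bool) → P b)
∀-Bool? P? = map′ (λ { (p , _) false → p ; (_ , p) true → p })
                  (λ p → p false , p true)
                  (P? false ×-dec P? true)

∃-Bool? : {P : Bool → Set} → ((b : Bool) → Dec (P b)) → Dec (∃ P)
∃-Bool? P? = map′ (λ { (inj₁ p) → false , p ; (inj₂ p) → true , p })
                  (λ { (false , p) → inj₁ p ; (true , p) → inj₂ p })
                  (P? false ⊎-dec P? true)

∀-M₂? : {P : M₂ → Set} → ((A : M₂) → Dec (P A)) → Dec ((A : M₂) → P A)
∀-M₂? P? =
  map′ (λ p A → p (a A) (b A) (c A) (d A)) (λ p a b c d → p (mat a b c d))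
       (∀-Bool? λ a → ∀-Bool? λ b → ∀-Bool? λ c → ∀-Bool? λ d → P? (mat a b c d))

∃-M₂? : {P : M₂ → Set} → ((A : M₂) → Dec (P A)) → Dec (∃ P)
∃-M₂? P? =
  map′ (λ (a , b , c , d , p) → mat a b c d , p) (λ (A , p) → a A , b A , c A , d A , p)
       (∃-Bool? λ a → ∃-Bool? λ b → ∃-Bool? λ c → ∃-Bool? λ d → P? (mat a b c d))

infix 4 _≟ᴹ_

_≟ᴹ_ : (A B : M₂) → Dec (A ≡ B)
mat a₁ b₁ c₁ d₁ ≟ᴹ mat a₂ b₂ c₂ d₂ =
  map′ (λ { (refl , refl , refl , refl) → refl }) (λ { refl → refl , refl , refl , refl })
       ((a₁ Bool.≟ a₂) ×-dec (b₁ Bool.≟ b₂) ×-dec (c₁ Bool.≟ c₂) ×-dec (d₁ Bool.≟ d₂))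

InP? : (k : ℕ) (C : M₂) → Dec (InP k C)
InP? k C = ∃-M₂? λ A → ∃-M₂? λ B → A ^ᴹ k ⊕ B ^ᴹ k ≟ᴹ C

Sums-of-powers : ℕ → Set
Sums-of-powers k =
  ((k % 6 ≢ 0) → (C : M₂) → InP k C)
  × ((k % 6 ≡ 0) → (C : M₂) → (InP k C ⇔ (C ≢ J₁ × C ≢ J₂)))

Sums-of-powers? : (k : ℕ) → Dec (Sums-of-powers k)
Sums-of-powers? k =
  (¬? (k % 6 ≟ 0) →-dec ∀-M₂? (InP? k))
  ×-dec (k % 6 ≟ 0 →-dec ∀-M₂? λ C →
           InP? k C ⇔-dec (¬? (C ≟ᴹ J₁) ×-dec ¬? (C ≟ᴹ J₂)))

^ᴹ8≡^ᴹ2 : (A : M₂) → A ^ᴹ 8 ≡ A ^ᴹ 2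
^ᴹ8≡^ᴹ2 = from-yes (∀-M₂? λ A → A ^ᴹ 8 ≟ᴹ A ^ᴹ 2)

^ᴹ-periodic : (A : M₂) (n : ℕ) → A ^ᴹ (6 + (2 + n)) ≡ A ^ᴹ (2 + n)
^ᴹ-periodic A 0       = ^ᴹ8≡^ᴹ2 A
^ᴹ-periodic A (suc n) = cong (A ⊗_) (^ᴹ-periodic A n)

InP-resp-^ᴹ : {k l : ℕ} {C : M₂} → (∀ A → A ^ᴹ k ≡ A ^ᴹ l) → InP k C → InP l C
InP-resp-^ᴹ k≈l (A , B , sum≡C) = A , B , trans (sym (cong₂ _⊕_ (k≈l A) (k≈l B))) sum≡C

InP-cong-^ᴹ : {k l : ℕ} {C : M₂} → (∀ A → A ^ᴹ k ≡ A ^ᴹ l) → InP k C ⇔ InP l C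
InP-cong-^ᴹ k≈l = mk⇔ (InP-resp-^ᴹ k≈l) (InP-resp-^ᴹ (λ A → sym (k≈l A)))

Sums-of-powers-transport : (k l : ℕ) → (∀ A → A ^ᴹ k ≡ A ^ᴹ l) → k % 6 ≡ l % 6 →
                           Sums-of-powers l → Sums-of-powers k
Sums-of-powers-transport k l k≈l k≡l (all , all-but-J) =
  (λ k≢0 C → from (InP-cong-^ᴹ k≈l) (all (λ l≡0 → k≢0 (trans k≡l l≡0)) C)) ,
  (λ k≡0 C → let P⇔J = all-but-J (trans (sym k≡l) k≡0) C in
     mk⇔ (λ p → to P⇔J (to (InP-cong-^ᴹ k≈l) p)) (λ q → from (InP-cong-^ᴹ k≈l) (from P⇔J q)))
  where open Equivalence

[6+n]%6≡n%6 : (n : ℕ) → (6 + n) % 6 ≡ n % 6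
[6+n]%6≡n%6 n = trans (cong (_% 6) (+-comm 6 n)) ([m+n]%n≡m%n n 6)

sums-of-powers : (n : ℕ) → Sums-of-powers (2 + n)
sums-of-powers 0 = from-yes (Sums-of-powers? 2)
sums-of-powers 1 = from-yes (Sums-of-powers? 3)
sums-of-powers 2 = from-yes (Sums-of-powers? 4)
sums-of-powers 3 = from-yes (Sums-of-powers? 5)
sums-of-powers 4 = from-yes (Sums-of-powers? 6)
sums-of-powers 5 = from-yes (Sums-of-powers? 7)
sums-of-powers (suc (suc (suc (suc (suc (suc n)))))) =
  Sums-of-powers-transport (8 + n) (2 + n) (λ A → ^ᴹ-periodic A n) ([6+n]%6≡n%6 (2 + n)) (sums-of-powers n)

theorem6p1 : (k : ℕ) → 2 ≤ k →
    ((k % 6 ≢ 0) → (C : M₂) → InP k C)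
    × ((k % 6 ≡ 0) → (C : M₂) → (InP k C ⇔ (C ≢ J₁ × C ≢ J₂)))
theorem6p1 (suc (suc n)) (s≤s (s≤s z≤n)) = sums-of-powers n
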